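{- Let $n\geq 2$ be finite, let $\mathfrak A\in TA_n$ and let $i\neq j<n$. Then $s_{ij}$ is a complete Boolean endomorphism of $\mathfrak A$: for every $X\subseteq A$ whose infimum $\prod X$ exists in $\mathfrak A$, the infimum $\prod\{s_{ij}x:x\in X\}$ exists and $s_{ij}\prod X=\prod\{s_{ij}x:x\in X\}$.
   Context: Fix a finite $n\geq 2$. A $TA_n$-type algebra is a Boolean algebra $(A,\wedge,\vee,-,0,1)$ with additional unary operations $s_{ij}$ for $i\neq j<n$. For a word $w=s_{i_1j_1}\cdots s_{i_kj_k}$ in these symbols put $\hat w=[i_1,j_1]\circ\cdots\circ[i_k,j_k]\in S_n$ (the empty word gives the identity), where $[i,j]$ is the transposition of $n$ swapping $i$ and $j$. $\Sigma_n$ is the set of equations: the Boolean algebra axioms; $s_{ij}(x\wedge y)=s_{ij}x\wedge s_{ij}y$; $s_{ij}(-x)=-s_{ij}x$; and $w_1(x)=w_2(x)$ for all words $w_1,w_2$ with $\hat w_1=\hat w_2$. $TA_n=\mathbf{Mod}(\Sigma_n)$. -}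

module Defs where

open import Level using (Level; _⊔_) renaming (suc to lsuc)
open import Data.Nat using (ℕ)
open import Data.Fin using (Fin)
open import Data.Fin.Permutation.Components using (transpose)
open import Data.List using (List; []; _∷_)
open import Data.Product using (Σ; _×_; _,_; ∃)
open import Relation.Binary.PropositionalEquality using (_≡_; _≢_)
open import Relation.Unary using (Pred)
open import Algebra.Lattice.Bundles using (BooleanAlgebra)
open import Function using (id; _∘_)

Idx : ℕ → Set
Idx n = Σ (Fin n × Fin n) (λ p → Data.Product.proj₁ p ≢ Data.Product.proj₂ p)

Word : ℕ → Set
Word n = List (Idx n)

hat : ∀ {n} → Word n → Fin n → Fin n
hat []                   = id
hat (((i , j) , _) ∷ w) = transpose i j ∘ hat w

_≗ₚ_ : ∀ {n} → (Fin n → Fin n) → (Fin n → Fin n) → Set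
f ≗ₚ g = ∀ k → f k ≡ g k

applyWord : ∀ {a} {A : Set a} {n} → ((i j : Fin n) → i ≢ j → A → A) → Word n → A → A
applyWord s []                   x = x
applyWord s (((i , j) , p) ∷ w) x = s i j p (applyWord s w x)

-- A TA_n algebra: a Boolean algebra (with setoid equality) with operations s_ij
-- satisfying Σ_n.  Operations respect the setoid equality (s-cong).
record TA {c ℓ : Level} (n : ℕ) : Set (lsuc (c ⊔ ℓ)) where
  field
    BA : BooleanAlgebra c ℓ
  open BooleanAlgebra BA public
  field
    s      : (i j : Fin n) → i ≢ j → Carrier → Carrier
    s-cong : ∀ i j (p : i ≢ j) {x y} → x ≈ y → s i j p x ≈ s i j p y
    s-∧    : ∀ i j (p : i ≢ j) x y → s i j p (x ∧ y) ≈ (s i j p x ∧ s i j p y)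
    s-¬    : ∀ i j (p : i ≢ j) x → s i j p (¬ x) ≈ ¬ (s i j p x)

    s-words : ∀ (w₁ w₂ : Word n) → hat w₁ ≗ₚ hat w₂ →
              ∀ x → applyWord s w₁ x ≈ applyWord s w₂ x

  _≤ᴮ_ : Carrier → Carrier → Set ℓ
  x ≤ᴮ y = (x ∧ y) ≈ x

  IsInf : ∀ {p} → Pred Carrier p → Carrier → Set (c ⊔ ℓ ⊔ p)
  IsInf X a = (∀ x → X x → a ≤ᴮ x) × (∀ b → (∀ x → X x → b ≤ᴮ x) → b ≤ᴮ a)

  image : ∀ {p} (i j : Fin n) → i ≢ j → Pred Carrier p → Pred Carrier (c ⊔ ℓ ⊔ p)
  image i j q X y = ∃ λ x → X x × (y ≈ s i j q x)

module Submission where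

-- Idea: s_ij is an order automorphism of the underlying Boolean algebra,
-- and an order automorphism preserves whatever infima exist.
--   * s_ij is monotone for the Boolean order x ≤ y ⟺ x ∧ y = x, because it
--     preserves meets (equation s_ij(x ∧ y) = s_ij x ∧ s_ij y of Σ_n).
--   * s_ij and s_ji are mutually inverse: the words s_ij s_ji and s_ji s_ij
--     both denote [i,j] ∘ [j,i] = id, so Σ_n identifies them with the empty
--     word.

open import Defs
open import Level using (Level; _⊔_)
open import Data.Nat using (ℕ; _≤_)
open import Data.Fin using (Fin)
open import Data.Fin.Permutation.Components using (transpose-inverse)
open import Data.List using ([]; _∷_)
open import Data.Product using (_,_; ∃; _×_)
open import Relation.Binary.PropositionalEquality using (_≢_; ≢-sym)
open import Relation.Unary using (Pred)

module _ {c ℓ : Level} {n : ℕ} (𝔄 : TA {c} {ℓ} n) where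
  open TA 𝔄

  ≤ᴮ-respʳ : ∀ {b y y′} → y ≈ y′ → b ≤ᴮ y → b ≤ᴮ y′
  ≤ᴮ-respʳ y≈y′ b≤y = trans (∧-cong refl (sym y≈y′)) b≤y

  ≤ᴮ-respˡ : ∀ {b b′ y} → b ≈ b′ → b ≤ᴮ y → b′ ≤ᴮ y
  ≤ᴮ-respˡ b≈b′ b≤y = trans (∧-cong (sym b≈b′) refl) (trans b≤y b≈b′)

  Monotone : (Carrier → Carrier) → Set (c ⊔ ℓ)
  Monotone f = ∀ {x y} → x ≤ᴮ y → f x ≤ᴮ f y

  Image : ∀ {p} → (Carrier → Carrier) → Pred Carrier p → Pred Carrier (c ⊔ ℓ ⊔ p)
  Image f X y = ∃ λ x → X x × (y ≈ f x)

  -- Lower bound: monotonicity of f.  Greatest: if b bounds f[X] from below,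
  -- then g b bounds X (apply g and cancel), so g b ≤ a and b ≈ f (g b) ≤ f a.
  automorphism-preserves-inf :
    (f g : Carrier → Carrier) → Monotone f → Monotone g →
    (∀ x → f (g x) ≈ x) → (∀ x → g (f x) ≈ x) →
    ∀ {p} (X : Pred Carrier p) (a : Carrier) →
    IsInf X a → IsInf (Image f X) (f a)
  automorphism-preserves-inf f g f-mono g-mono fg≈id gf≈id X a (a-lower , a-greatest) =
    fa-lower , fa-greatest
    where
    fa-lower : ∀ y → Image f X y → f a ≤ᴮ y
    fa-lower y (x , x∈X , y≈fx) = ≤ᴮ-respʳ (sym y≈fx) (f-mono (a-lower x x∈X))

    fa-greatest : ∀ b → (∀ y → Image f X y → b ≤ᴮ y) → b ≤ᴮ f a
    fa-greatest b b-lower = ≤ᴮ-respˡ (fg≈id b) (f-mono (a-greatest (g b) gb-lower))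
      where
      gb-lower : ∀ x → X x → g b ≤ᴮ x
      gb-lower x x∈X = ≤ᴮ-respʳ (gf≈id x) (g-mono (b-lower (f x) (x , x∈X , refl)))

  -- s_ij preserves meets, hence is monotone for the Boolean order.
  s-monotone : ∀ i j (q : i ≢ j) → Monotone (s i j q)
  s-monotone i j q {x} {y} x≤y = trans (sym (s-∧ i j q x y)) (s-cong i j q x≤y)

  -- s_ij ∘ s_ji = id, since the word s_ij s_ji denotes [i,j] ∘ [j,i] = id.
  s-cancel : ∀ i j (q : i ≢ j) (q′ : j ≢ i) x → s i j q (s j i q′ x) ≈ x
  s-cancel i j q q′ =
    s-words (((i , j) , q) ∷ ((j , i) , q′) ∷ []) [] (λ _ → transpose-inverse i j)

mainTheorem1 : ∀ {c ℓ p : Level} (n : ℕ) → 2 ≤ n → (𝔄 : TA {c} {ℓ} n) →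
    (i j : Fin n) (q : i ≢ j) (X : Pred (TA.Carrier 𝔄) p) (a : TA.Carrier 𝔄) →
    TA.IsInf 𝔄 X a → TA.IsInf 𝔄 (TA.image 𝔄 i j q X) (TA.s 𝔄 i j q a)
mainTheorem1 n _ 𝔄 i j q X a =
  automorphism-preserves-inf 𝔄 (s i j q) (s j i q′)
    (s-monotone 𝔄 i j q) (s-monotone 𝔄 j i q′)
    (s-cancel 𝔄 i j q q′) (s-cancel 𝔄 j i q′ q) X a
  where
  open TA 𝔄
  q′ : j ≢ i
  q′ = ≢-sym q
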